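{- Let $n\geq 8$ and let $\sigma\in S_n$ be a vertex of the difference graph $D(S_n)$. If the order of $\sigma$ is $p^\alpha$ for some odd prime $p$, then there is a path in $D(S_n)$ joining $\sigma$ to some transposition $(a_1a_2)$.
   Context: For a group $G$, the power graph $\mathsf{Pow}(G)$ has vertex set $G$, with distinct $a,b$ adjacent iff $a\in\langle b\rangle$ or $b\in\langle a\rangle$. The enhanced power graph $\mathsf{EPow}(G)$ has vertex set $G$, with distinct $a,b$ adjacent iff $\langle a,b\rangle$ is cyclic. The difference graph $D(G)$ is the graph $\mathsf{EPow}(G)-\mathsf{Pow}(G)$ with all isolated vertices removed; thus $x\sim y$ in $D(G)$ iff $\langle x,y\rangle$ is cyclic, $x\notin\langle y\rangle$ and $y\notin\langle x\rangle$. $S_n$ is the symmetric group on $\{1,\dots,n\}$. -}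

module Defs where

open import Data.Nat using (ℕ; zero; suc; _<_; _^_)
open import Data.Nat.Primality using (Prime)
open import Data.Nat.Divisibility using (_∣_)
open import Data.Fin using (Fin)
open import Data.Fin.Permutation
  using (Permutation′; _∘ₚ_; flip; id; transpose; _≈_)
open import Data.Product using (Σ; ∃; _×_; _,_)
open import Data.Sum using (_⊎_)
open import Relation.Nullary using (¬_)
open import Relation.Binary.PropositionalEquality using (_≢_)
open import Relation.Binary.Construct.Closure.ReflexiveTransitive using (Star)

-- The symmetric group S_n : permutations of Fin n = {0,…,n-1},
-- with extensional (pointwise) equality _≈_, product _∘ₚ_,
-- inverse flip, identity id.
S : ℕ → Set
S n = Permutation′ n

_^ₚ_ : ∀ {n} → S n → ℕ → S n
σ ^ₚ zero = id
σ ^ₚ suc k = σ ∘ₚ (σ ^ₚ k)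

_∈⟨_⟩ : ∀ {n} → S n → S n → Set
x ∈⟨ y ⟩ = ∃ λ k → (x ≈ (y ^ₚ k)) ⊎ (x ≈ (flip y ^ₚ k))

data _∈⟪_,_⟫ {n} : S n → S n → S n → Set where
  gen-id  : ∀ {a b} → id ∈⟪ a , b ⟫
  gen-a   : ∀ {a b} → a ∈⟪ a , b ⟫
  gen-b   : ∀ {a b} → b ∈⟪ a , b ⟫
  gen-mul : ∀ {a b x y} → x ∈⟪ a , b ⟫ → y ∈⟪ a , b ⟫ → (x ∘ₚ y) ∈⟪ a , b ⟫
  gen-inv : ∀ {a b x} → x ∈⟪ a , b ⟫ → flip x ∈⟪ a , b ⟫
  gen-≈   : ∀ {a b x y} → x ≈ y → x ∈⟪ a , b ⟫ → y ∈⟪ a , b ⟫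

-- ⟨a , b⟩ is cyclic: it has a generator g (g ∈ ⟨a,b⟩ and a, b ∈ ⟨g⟩,
-- hence ⟨a,b⟩ = ⟨g⟩)
CyclicPair : ∀ {n} → S n → S n → Set
CyclicPair a b = Σ _ λ g → g ∈⟪ a , b ⟫ × a ∈⟨ g ⟩ × b ∈⟨ g ⟩

DAdj : ∀ {n} → S n → S n → Set
DAdj x y = CyclicPair x y × ¬ (x ∈⟨ y ⟩) × ¬ (y ∈⟨ x ⟩)

-- x is a vertex of D(S_n) (not isolated in EPow - Pow)
DVertex : ∀ {n} → S n → Set
DVertex x = ∃ λ y → DAdj x y

DPath : ∀ {n} → S n → S n → Set
DPath = Star DAdj

HasOrder : ∀ {n} → S n → ℕ → Set
HasOrder σ m = 0 < m × (σ ^ₚ m) ≈ id × (∀ k → 0 < k → k < m → ¬ ((σ ^ₚ k) ≈ id))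

IsTransposition : ∀ {n} → S n → Set
IsTransposition {n} τ = Σ (Fin n) λ a₁ → Σ (Fin n) λ a₂ → a₁ ≢ a₂ × τ ≈ transpose a₁ a₂

-- The neighbour y of σ in D(Sₙ) lies with σ in a cyclic group ⟨g⟩. As neither of σ, y is a power
-- of the other, ⟨g⟩ is not a p-group, so some power h of g has prime order q ≠ p. Commuting elements
-- of coprime orders are always adjacent in D (both are powers of their product, and neither is a
-- power of the other), so σ ~ h, and it remains to join h to a transposition, using n ≥ 8 for room.
-- If q = 2 and h moves at most four points, h commutes with a 3-cycle on three of its fixed points,
-- which commutes with a transposition of two further points; if h moves six points a, ha, b, hb, c, hc,
-- then (h f h) f with f = (a b c) has order 3, commutes with h and fixes two points. If q is odd,
-- either h fixes two points and is adjacent to their transposition, or h has two nontrivial orbits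
-- and the involution swapping them commutes with h, reducing to q = 2; otherwise every element
-- commuting with h is a power of h, which σ, of order coprime to q, cannot be.

module Submission where

open import Defs
open import Data.Nat
  using (ℕ; zero; suc; _+_; _*_; _∸_; _^_; _≤_; _<_; z≤n; s≤s; NonZero; _%_; _/_; _≟_;
         >-nonZero; >-nonZero⁻¹; nonTrivial⇒n>1)
open import Data.Nat.Properties
open import Data.Nat.Induction using (Acc; acc; <-wellFounded)
open import Data.Nat.DivMod using (m≡m%n+[m/n]*n; m%n<n)
open import Data.Nat.Divisibility using (_∣_; divides; _∣?_; _∣0; ∣-trans; ∣-refl; ∣1⇒≡1)
open import Data.Nat.Divisibility.Core using (hasNonTrivialDivisor)
open import Data.Nat.Coprimality
  using (Coprime; coprime?; coprime-Bézout; coprime-divisor; prime⇒coprime; 0-coprimeTo-m⇒m≡1)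
  renaming (sym to coprime-sym)
open import Data.Nat.GCD using (module Bézout)
open import Data.Nat.Primality
  using (Prime; prime?; ¬prime⇒composite; prime⇒irreducible; prime⇒nonZero; prime⇒nonTrivial)
open import Data.Nat.ListAction using (product)
open import Data.Nat.ListAction.Properties using (∈⇒∣product; product≢0)
open import Data.Nat.Tactic.RingSolver using (solve-∀)
open import Data.Fin using (Fin; toℕ; fromℕ<)
open import Data.Fin.Properties
  using (pigeonhole; any?; all?; ¬∀⟶∃¬; <⇒notInjective; toℕ-fromℕ<) renaming (_≟_ to _≟ᶠ_)
open import Data.Fin.Permutation
  using (_⟨$⟩ʳ_; _⟨$⟩ˡ_; inverseˡ; _∘ₚ_; flip; id; _≈_; transpose; permutation)
open import Data.List using (List; []; _∷_; length; lookup; map; _++_; allFin)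
open import Data.List.Membership.Propositional using (_∈_; _∉_)
open import Data.List.Membership.Propositional.Properties using (∈-map⁺; ∈-++⁺ˡ; ∈-++⁺ʳ; ∈-allFin)
open import Data.List.Membership.DecPropositional using () renaming (_∈?_ to ∈?-with)
open import Data.List.Relation.Unary.Any using (here; there; index)
open import Data.List.Relation.Unary.Any.Properties using (lookup-index)
open import Data.List.Relation.Unary.All using (All; []; _∷_; universal) renaming (lookup to All-lookup)
open import Data.List.Relation.Unary.All.Properties using (map⁺)
open import Relation.Binary.Construct.Closure.ReflexiveTransitive using (ε; _◅_)
open import Data.Product using (Σ; ∃; ∃₂; _×_; _,_; proj₁; proj₂)
open import Data.Sum using (_⊎_; inj₁; inj₂; [_,_]) renaming (swap to ⊎-swap)
open import Function using (_∘_)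
open import Relation.Nullary using (¬_; contradiction; Dec; yes; no; ¬?)
open import Relation.Nullary.Decidable using (_×-dec_; decidable-stable; from-yes)
open import Relation.Binary.PropositionalEquality
  using (_≡_; _≢_; refl; sym; trans; cong; subst; ≢-sym; module ≡-Reasoning)
open ≡-Reasoning

bezout⁺ : ∀ {a b} → Coprime a b → 0 < a → ∃₂ λ s t → s * a ≡ 1 + t * b
bezout⁺ c a>0 with coprime-Bézout c
... | Bézout.+- s t eq = s , t , sym eq
bezout⁺ {b = zero} _ _ | Bézout.-+ s t eq = contradiction (trans eq (*-zeroʳ t)) λ ()
bezout⁺ {a = suc a} {b = 1} _ _ | Bézout.-+ _ _ _ =
  1 , a , cong suc (trans (+-identityʳ a) (sym (*-identityʳ a)))
bezout⁺ {b = suc (suc b)} _ _ | Bézout.-+ s zero ()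
-- From 1 + s a ≡ t (b + 2), multiplying by b + 1 gives (b + 1) s a ≡ 1 (mod b + 2).
bezout⁺ {a = a} {b = suc (suc b)} _ _ | Bézout.-+ s (suc t) eq =
  suc b * s , t + b * suc t , +-cancelʳ-≡ (suc b) _ _ (begin
    suc b * s * a + suc b             ≡⟨ left b s a ⟩
    suc b * (1 + s * a)               ≡⟨ cong (suc b *_) eq ⟩
    suc b * (suc t * suc (suc b))     ≡⟨ right b t ⟨
    1 + (t + b * suc t) * suc (suc b) + suc b ∎)
  where
  left : ∀ b s a → (1 + b) * s * a + (1 + b) ≡ (1 + b) * (1 + s * a)
  left = solve-∀
  right : ∀ b t → 1 + (t + b * (1 + t)) * (2 + b) + (1 + b) ≡ (1 + b) * ((1 + t) * (2 + b))
  right = solve-∀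

p-adic-decomposition : ∀ {p} → 1 < p → ∀ i → 0 < i → ∃₂ λ a u → i ≡ p ^ a * u × ¬ p ∣ u
p-adic-decomposition {p} p>1 i i>0 = go i i>0 (<-wellFounded i)
  where
  shift : ∀ p pᵃ u → pᵃ * u * p ≡ p * pᵃ * u
  shift = solve-∀
  go : ∀ i → 0 < i → Acc _<_ i → ∃₂ λ a u → i ≡ p ^ a * u × ¬ p ∣ u
  go i i>0 (acc rec) with p ∣? i
  ... | no p∤i = 0 , i , sym (+-identityʳ i) , p∤i
  ... | yes (divides zero i≡0) = contradiction i≡0 (>⇒≢ i>0)
  ... | yes (divides k@(suc _) i≡kp) with go k (s≤s z≤n) (rec (subst (k <_) (sym i≡kp) (m<m*n k p p>1)))
  ...   | a , u , k≡pᵃu , p∤u = suc a , u , trans i≡kp (trans (cong (_* p) k≡pᵃu) (shift p (p ^ a) u)) , p∤u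

prime∤⇒coprime : ∀ {p u} → Prime p → ¬ p ∣ u → Coprime u p
prime∤⇒coprime pp p∤u (d∣u , d∣p) with prime⇒irreducible pp d∣p
... | inj₁ d≡1 = d≡1
... | inj₂ refl = contradiction d∣u p∤u

coprime-*ʳ : ∀ {u a b} → Coprime u a → Coprime u b → Coprime u (a * b)
coprime-*ʳ {a = a} u⊥a u⊥b {d} (d∣u , d∣ab) = u⊥b (d∣u , coprime-divisor d⊥a d∣ab)
  where
  d⊥a : Coprime d a
  d⊥a (e∣d , e∣a) = u⊥a (∣-trans e∣d d∣u , e∣a)

coprime-^ʳ : ∀ {u p} → Coprime u p → ∀ c → Coprime u (p ^ c)
coprime-^ʳ _    zero    (_ , d∣1) = ∣1⇒≡1 d∣1
coprime-^ʳ u⊥p (suc c) = coprime-*ʳ u⊥p (coprime-^ʳ u⊥p c)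

module _ {n : ℕ} where

  infixr 6 _·_

  _·_ : S n → Fin n → Fin n
  x · z = x ⟨$⟩ʳ z

  Commute : S n → S n → Set
  Commute x y = ∀ z → x · y · z ≡ y · x · z

  ·-injective : (x : S n) {u v : Fin n} → x · u ≡ x · v → u ≡ v
  ·-injective x {u} {v} e = begin
    u                 ≡⟨ inverseˡ x ⟨
    x ⟨$⟩ˡ (x · u)    ≡⟨ cong (x ⟨$⟩ˡ_) e ⟩
    x ⟨$⟩ˡ (x · v)    ≡⟨ inverseˡ x ⟩
    v                 ∎

  Commute-sym : {x y : S n} → Commute x y → Commute y x
  Commute-sym c z = sym (c z)

  ^ₚ-self-commute : ∀ (x : S n) k → Commute (x ^ₚ k) x
  ^ₚ-self-commute x zero z = refl
  ^ₚ-self-commute x (suc k) z = ^ₚ-self-commute x k (x · z)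

  ^ₚ-+ : ∀ (x : S n) a b → x ^ₚ (a + b) ≈ (x ^ₚ b) ∘ₚ (x ^ₚ a)
  ^ₚ-+ x zero b z = refl
  ^ₚ-+ x (suc a) b z = trans (^ₚ-+ x a b (x · z)) (cong ((x ^ₚ a) ·_) (^ₚ-self-commute x b z))

  ^ₚ-* : ∀ (x : S n) a b → x ^ₚ (a * b) ≈ (x ^ₚ a) ^ₚ b
  ^ₚ-* x a zero z rewrite *-zeroʳ a = refl
  ^ₚ-* x a (suc b) z rewrite *-suc a b = begin
    (x ^ₚ (a + a * b)) · z               ≡⟨ ^ₚ-+ x a (a * b) z ⟩
    (x ^ₚ a) · (x ^ₚ (a * b)) · z        ≡⟨ cong ((x ^ₚ a) ·_) (^ₚ-* x a b z) ⟩
    (x ^ₚ a) · ((x ^ₚ a) ^ₚ b) · z       ≡⟨ ^ₚ-self-commute (x ^ₚ a) b z ⟨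
    ((x ^ₚ a) ^ₚ suc b) · z              ∎

  ^ₚ-cong : ∀ {x y : S n} k → x ≈ y → x ^ₚ k ≈ y ^ₚ k
  ^ₚ-cong zero e z = refl
  ^ₚ-cong {x} {y} (suc k) e z = trans (^ₚ-cong k e (x · z)) (cong ((y ^ₚ k) ·_) (e z))

  ^ₚ-commute : ∀ (x : S n) i j → Commute (x ^ₚ i) (x ^ₚ j)
  ^ₚ-commute x i j z = begin
    (x ^ₚ i) · (x ^ₚ j) · z   ≡⟨ ^ₚ-+ x i j z ⟨
    (x ^ₚ (i + j)) · z        ≡⟨ cong (λ k → (x ^ₚ k) · z) (+-comm i j) ⟩
    (x ^ₚ (j + i)) · z        ≡⟨ ^ₚ-+ x j i z ⟩
    (x ^ₚ j) · (x ^ₚ i) · z   ∎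

  ^ₚ-fixes : ∀ (x : S n) {z} k → x · z ≡ z → (x ^ₚ k) · z ≡ z
  ^ₚ-fixes x zero e = refl
  ^ₚ-fixes x (suc k) e = trans (cong ((x ^ₚ k) ·_) e) (^ₚ-fixes x k e)

  ^ₚ-*-fixes : ∀ (x : S n) {z m} k → (x ^ₚ m) · z ≡ z → (x ^ₚ (k * m)) · z ≡ z
  ^ₚ-*-fixes x {z} {m} k e = begin
    (x ^ₚ (k * m)) · z     ≡⟨ cong (λ t → (x ^ₚ t) · z) (*-comm k m) ⟩
    (x ^ₚ (m * k)) · z     ≡⟨ ^ₚ-* x m k z ⟩
    ((x ^ₚ m) ^ₚ k) · z    ≡⟨ ^ₚ-fixes (x ^ₚ m) k e ⟩
    z                      ∎

  ^ₚ-*-≈id : ∀ (x : S n) {m} k → x ^ₚ m ≈ id → x ^ₚ (k * m) ≈ id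
  ^ₚ-*-≈id x {m} k e z = ^ₚ-*-fixes x {m = m} k (e z)

  ≈^ₚ-^ₚ : ∀ {x y : S n} k r → x ≈ y ^ₚ k → x ^ₚ r ≈ y ^ₚ (k * r)
  ≈^ₚ-^ₚ {x} {y} k r x≈yᵏ z = trans (^ₚ-cong r x≈yᵏ z) (sym (^ₚ-* y k r z))

  ≈^ₚ⇒^ₚ≈id : ∀ {x y : S n} k b → x ≈ y ^ₚ k → y ^ₚ b ≈ id → x ^ₚ b ≈ id
  ≈^ₚ⇒^ₚ≈id {y = y} k b x≈yᵏ yᵇ≈id z = trans (≈^ₚ-^ₚ k b x≈yᵏ z) (^ₚ-*-≈id y {b} k yᵇ≈id z)

  Commute-^ₚʳ : ∀ {x y : S n} → Commute x y → ∀ j → Commute x (y ^ₚ j)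
  Commute-^ₚʳ c zero z = refl
  Commute-^ₚʳ {x} {y} c (suc j) z = trans (Commute-^ₚʳ {x} {y} c j (y · z)) (cong ((y ^ₚ j) ·_) (c z))

  Commute-^ₚ : ∀ {x y : S n} → Commute x y → ∀ i j → Commute (x ^ₚ i) (y ^ₚ j)
  Commute-^ₚ c zero j z = refl
  Commute-^ₚ {x} {y} c (suc i) j z =
    trans (cong ((x ^ₚ i) ·_) (Commute-^ₚʳ {x} {y} c j z)) (Commute-^ₚ {x} {y} c i j (x · z))

  Commute⇒∘ₚ-^ₚ : ∀ {x y : S n} → Commute x y → ∀ k → (x ∘ₚ y) ^ₚ k ≈ (y ^ₚ k) ∘ₚ (x ^ₚ k)
  Commute⇒∘ₚ-^ₚ c zero z = refl
  Commute⇒∘ₚ-^ₚ {x} {y} c (suc k) z =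
    trans (Commute⇒∘ₚ-^ₚ {x} {y} c k (y · x · z)) (cong ((x ^ₚ k) ·_) (sym (Commute-^ₚʳ {x} {y} c (suc k) z)))

  powers-commute : ∀ {g x y : S n} i j → x ≈ g ^ₚ i → y ≈ g ^ₚ j → Commute x y
  powers-commute {g} {x} {y} i j x≈gⁱ y≈gʲ z = begin
    x · y · z                 ≡⟨ x≈gⁱ (y · z) ⟩
    (g ^ₚ i) · y · z          ≡⟨ cong ((g ^ₚ i) ·_) (y≈gʲ z) ⟩
    (g ^ₚ i) · (g ^ₚ j) · z   ≡⟨ ^ₚ-commute g i j z ⟩
    (g ^ₚ j) · (g ^ₚ i) · z   ≡⟨ y≈gʲ ((g ^ₚ i) · z) ⟨
    y · (g ^ₚ i) · z          ≡⟨ cong (y ·_) (x≈gⁱ z) ⟨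
    y · x · z                 ∎

  -- Adjacency in the difference graph

  fixed-by-bezout-powers : ∀ (x : S n) a b s t {z} → 1 + t * b ≡ s * a →
                           (x ^ₚ a) · z ≡ z → (x ^ₚ b) · z ≡ z → x · z ≡ z
  fixed-by-bezout-powers x a b s t {z} eq xᵃz≡z xᵇz≡z = begin
    x · z                     ≡⟨ cong (x ·_) (^ₚ-*-fixes x t xᵇz≡z) ⟨
    x · (x ^ₚ (t * b)) · z    ≡⟨ ^ₚ-self-commute x (t * b) z ⟨
    (x ^ₚ (1 + t * b)) · z    ≡⟨ cong (λ k → (x ^ₚ k) · z) eq ⟩
    (x ^ₚ (s * a)) · z        ≡⟨ ^ₚ-*-fixes x s xᵃz≡z ⟩
    z                         ∎

  fixed-by-coprime-powers : ∀ (x : S n) a b {z} → Coprime a b →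
                            (x ^ₚ a) · z ≡ z → (x ^ₚ b) · z ≡ z → x · z ≡ z
  fixed-by-coprime-powers x a b c xᵃz≡z xᵇz≡z with coprime-Bézout c
  ... | Bézout.+- s t eq = fixed-by-bezout-powers x a b s t eq xᵃz≡z xᵇz≡z
  ... | Bézout.-+ s t eq = fixed-by-bezout-powers x b a t s eq xᵇz≡z xᵃz≡z

  coprime-powers⇒≈id : ∀ {x : S n} a b → Coprime a b → x ^ₚ a ≈ id → x ^ₚ b ≈ id → x ≈ id
  coprime-powers⇒≈id {x} a b c xᵃ≈id xᵇ≈id z = fixed-by-coprime-powers x a b c (xᵃ≈id z) (xᵇ≈id z)

  flip≈^ₚ : ∀ (y : S n) N → y ^ₚ suc N ≈ id → flip y ≈ y ^ₚ N
  flip≈^ₚ y N yᴺ⁺¹≈id z = begin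
    flip y · z                      ≡⟨ cong (flip y ·_) (yᴺ⁺¹≈id z) ⟨
    flip y · (y ^ₚ suc N) · z       ≡⟨ cong (flip y ·_) (^ₚ-self-commute y N z) ⟩
    flip y · y · (y ^ₚ N) · z       ≡⟨ inverseˡ y ⟩
    (y ^ₚ N) · z                    ∎

  ∈⟨⟩⇒≈^ₚ : ∀ {x y : S n} N → 0 < N → y ^ₚ N ≈ id → x ∈⟨ y ⟩ → ∃ λ k → x ≈ y ^ₚ k
  ∈⟨⟩⇒≈^ₚ _ _ _ (k , inj₁ x≈yᵏ) = k , x≈yᵏ
  ∈⟨⟩⇒≈^ₚ {x} {y} (suc N) _ yᴺ⁺¹≈id (k , inj₂ x≈y⁻ᵏ) = N * k , λ z → begin
    x · z                     ≡⟨ x≈y⁻ᵏ z ⟩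
    (flip y ^ₚ k) · z         ≡⟨ ^ₚ-cong k (flip≈^ₚ y N yᴺ⁺¹≈id) z ⟩
    ((y ^ₚ N) ^ₚ k) · z       ≡⟨ ^ₚ-* y N k z ⟨
    (y ^ₚ (N * k)) · z        ∎

  coprime-orders⇒∉⟨⟩ : ∀ {x y : S n} a b → Coprime a b → 0 < b →
                       x ^ₚ a ≈ id → y ^ₚ b ≈ id → ¬ x ≈ id → ¬ x ∈⟨ y ⟩
  coprime-orders⇒∉⟨⟩ {x} {y} a b c b>0 xᵃ≈id yᵇ≈id x≉id x∈⟨y⟩ with ∈⟨⟩⇒≈^ₚ {x} {y} b b>0 yᵇ≈id x∈⟨y⟩
  ... | k , x≈yᵏ = x≉id (coprime-powers⇒≈id a b c xᵃ≈id (≈^ₚ⇒^ₚ≈id k b x≈yᵏ yᵇ≈id))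

  ∉⟨⟩⇒≉id : ∀ {x y : S n} → ¬ x ∈⟨ y ⟩ → ¬ x ≈ id
  ∉⟨⟩⇒≉id x∉⟨y⟩ x≈id = x∉⟨y⟩ (0 , inj₁ x≈id)

  coprime-to-nontrivial-order⇒0< : ∀ {y : S n} a b → Coprime a b → y ^ₚ b ≈ id → ¬ y ≈ id → 0 < a
  coprime-to-nontrivial-order⇒0< {y} zero b c yᵇ≈id y≉id =
    contradiction (λ z → subst (λ k → (y ^ₚ k) · z ≡ z) (0-coprimeTo-m⇒m≡1 c) (yᵇ≈id z)) y≉id
  coprime-to-nontrivial-order⇒0< (suc _) _ _ _ _ = s≤s z≤n

  Commute⇒power-of-∘ₚ : ∀ {x y : S n} a b → Commute x y → Coprime a b → 0 < a →
                          x ^ₚ a ≈ id → y ^ₚ b ≈ id → ∃ λ k → y ≈ (x ∘ₚ y) ^ₚ k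
  Commute⇒power-of-∘ₚ {x} {y} a b c cop a>0 xᵃ≈id yᵇ≈id with bezout⁺ cop a>0
  ... | s , t , sa≡1+tb = s * a , λ z → sym (begin
    ((x ∘ₚ y) ^ₚ (s * a)) · z               ≡⟨ Commute⇒∘ₚ-^ₚ {x} {y} c (s * a) z ⟩
    (x ^ₚ (s * a)) · (y ^ₚ (s * a)) · z     ≡⟨ ^ₚ-*-≈id x {a} s xᵃ≈id _ ⟩
    (y ^ₚ (s * a)) · z                      ≡⟨ cong (λ k → (y ^ₚ k) · z) sa≡1+tb ⟩
    (y ^ₚ (t * b)) · y · z                  ≡⟨ ^ₚ-*-≈id y {b} t yᵇ≈id _ ⟩
    y · z                                   ∎)

  commuting-coprime⇒adjacent : ∀ {x y : S n} a b → Commute x y → Coprime a b →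
                               x ^ₚ a ≈ id → y ^ₚ b ≈ id → ¬ x ≈ id → ¬ y ≈ id → DAdj x y
  commuting-coprime⇒adjacent {x} {y} a b c cop xᵃ≈id yᵇ≈id x≉id y≉id =
    (x ∘ₚ y , gen-mul gen-a gen-b , x∈⟨xy⟩ , y∈⟨xy⟩) ,
    coprime-orders⇒∉⟨⟩ a b cop b>0 xᵃ≈id yᵇ≈id x≉id ,
    coprime-orders⇒∉⟨⟩ b a (coprime-sym cop) a>0 yᵇ≈id xᵃ≈id y≉id
    where
    a>0 = coprime-to-nontrivial-order⇒0< a b cop yᵇ≈id y≉id
    b>0 = coprime-to-nontrivial-order⇒0< b a (coprime-sym cop) xᵃ≈id x≉id
    y∈⟨xy⟩ : y ∈⟨ x ∘ₚ y ⟩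
    y∈⟨xy⟩ with Commute⇒power-of-∘ₚ {x} {y} a b c cop a>0 xᵃ≈id yᵇ≈id
    ... | k , y≈ = k , inj₁ y≈
    x∈⟨xy⟩ : x ∈⟨ x ∘ₚ y ⟩
    x∈⟨xy⟩ with Commute⇒power-of-∘ₚ {y} {x} b a (Commute-sym {x} {y} c) (coprime-sym cop) b>0 yᵇ≈id xᵃ≈id
    ... | k , x≈ = k , inj₁ λ z → trans (x≈ z) (^ₚ-cong k c z)

  infix 4 _≈?_

  _≈?_ : (x y : S n) → Dec (x ≈ y)
  x ≈? y = all? (λ z → x · z ≟ᶠ y · z)

  point-period : (x : S n) (a : Fin n) → ∃ λ d → 0 < d × (x ^ₚ d) · a ≡ a
  point-period x a with pigeonhole (n<1+n n) (λ i → (x ^ₚ toℕ i) · a)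
  ... | i , j , i<j , xⁱa≡xʲa = d , m<n⇒0<n∸m i<j , ·-injective (x ^ₚ toℕ i) (begin
    (x ^ₚ toℕ i) · (x ^ₚ d) · a   ≡⟨ ^ₚ-+ x (toℕ i) d a ⟨
    (x ^ₚ (toℕ i + d)) · a        ≡⟨ cong (λ k → (x ^ₚ k) · a) (m+[n∸m]≡n (<⇒≤ i<j)) ⟩
    (x ^ₚ toℕ j) · a              ≡⟨ xⁱa≡xʲa ⟨
    (x ^ₚ toℕ i) · a              ∎)
    where d = toℕ j ∸ toℕ i

  finite-order : (x : S n) → ∃ λ N → 0 < N × x ^ₚ N ≈ id
  finite-order x = N , >-nonZero⁻¹ N {{N≢0}} , xᴺ≈id
    where
    period : Fin n → ℕ
    period a = proj₁ (point-period x a)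
    N = product (map period (allFin n))
    N≢0 : NonZero N
    N≢0 = product≢0 (map⁺ (universal (λ a → >-nonZero (proj₁ (proj₂ (point-period x a)))) (allFin n)))
    xᴺ≈id : x ^ₚ N ≈ id
    xᴺ≈id a with ∈⇒∣product (∈-map⁺ period (∈-allFin a))
    ... | divides k N≡k*d = subst (λ m → (x ^ₚ m) · a ≡ a) (sym N≡k*d)
                              (^ₚ-*-fixes x k (proj₂ (proj₂ (point-period x a))))

  coprime-cofactor⇒power : ∀ {g σ : S n} A u P → σ ≈ g ^ₚ (A * u) → Coprime u P → 0 < u →
                           g ^ₚ P ≈ id → ∃ λ e → g ^ₚ A ≈ σ ^ₚ e
  coprime-cofactor⇒power {g} {σ} A u P σ≈gᴬᵘ u⊥P u>0 gᴾ≈id with bezout⁺ u⊥P u>0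
  ... | s , t , su≡1+tP = s , λ z → sym (begin
    (σ ^ₚ s) · z                          ≡⟨ ≈^ₚ-^ₚ (A * u) s σ≈gᴬᵘ z ⟩
    (g ^ₚ (A * u * s)) · z                ≡⟨ cong (λ k → (g ^ₚ k) · z) exponent ⟩
    (g ^ₚ (A + A * t * P)) · z            ≡⟨ ^ₚ-+ g A (A * t * P) z ⟩
    (g ^ₚ A) · (g ^ₚ (A * t * P)) · z     ≡⟨ cong ((g ^ₚ A) ·_) (^ₚ-*-≈id g {P} (A * t) gᴾ≈id z) ⟩
    (g ^ₚ A) · z                          ∎)
    where
    exponent : A * u * s ≡ A + A * t * P
    exponent = begin
      A * u * s           ≡⟨ reassoc A u s ⟩
      A * (s * u)         ≡⟨ cong (A *_) su≡1+tP ⟩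
      A * (1 + t * P)     ≡⟨ distrib A t P ⟩
      A + A * t * P       ∎
      where
      reassoc : ∀ A u s → A * u * s ≡ A * (s * u)
      reassoc = solve-∀
      distrib : ∀ A t P → A * (1 + t * P) ≡ A + A * t * P
      distrib = solve-∀

  smaller-valuation⇒∈⟨⟩ : ∀ {g x w : S n} p c a b u v → Prime p → g ^ₚ (p ^ c) ≈ id →
                          x ≈ g ^ₚ (p ^ a * u) → w ≈ g ^ₚ (p ^ b * v) → ¬ p ∣ u → a ≤ b → w ∈⟨ x ⟩
  smaller-valuation⇒∈⟨⟩ {g} {x} {w} p c a b u v pp gᵖᶜ≈id x≈ w≈ p∤u a≤b
    with coprime-cofactor⇒power (p ^ a) u (p ^ c) x≈ (coprime-^ʳ (prime∤⇒coprime pp p∤u) c) u>0 gᵖᶜ≈id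
    where
    u>0 : 0 < u
    u>0 = n≢0⇒n>0 λ { refl → p∤u (p ∣0) }
  ... | e , gᵖᵃ≈xᵉ = e * r , inj₁ λ z → begin
    w · z                          ≡⟨ w≈ z ⟩
    (g ^ₚ (p ^ b * v)) · z         ≡⟨ cong (λ k → (g ^ₚ k) · z) split ⟩
    (g ^ₚ (p ^ a * r)) · z         ≡⟨ ^ₚ-* g (p ^ a) r z ⟩
    ((g ^ₚ (p ^ a)) ^ₚ r) · z      ≡⟨ ≈^ₚ-^ₚ e r gᵖᵃ≈xᵉ z ⟩
    (x ^ₚ (e * r)) · z             ∎
    where
    r = p ^ (b ∸ a) * v
    split : p ^ b * v ≡ p ^ a * r
    split = begin
      p ^ b * v                  ≡⟨ cong (λ k → p ^ k * v) (m+[n∸m]≡n a≤b) ⟨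
      p ^ (a + (b ∸ a)) * v      ≡⟨ cong (_* v) (^-distribˡ-+-* p a (b ∸ a)) ⟩
      p ^ a * p ^ (b ∸ a) * v    ≡⟨ *-assoc (p ^ a) _ v ⟩
      p ^ a * r                  ∎

  prime-power-cyclic⇒comparable : ∀ {g x y : S n} p c i j → Prime p → g ^ₚ (p ^ c) ≈ id →
                                  x ≈ g ^ₚ i → y ≈ g ^ₚ j → ¬ x ≈ id → ¬ y ≈ id → x ∈⟨ y ⟩ ⊎ y ∈⟨ x ⟩
  prime-power-cyclic⇒comparable p c zero j pp _ x≈id _ x≉id _ = contradiction x≈id x≉id
  prime-power-cyclic⇒comparable p c (suc _) zero pp _ _ y≈id _ y≉id = contradiction y≈id y≉id
  prime-power-cyclic⇒comparable {g} {x} {y} p c i@(suc _) j@(suc _) pp gᵖᶜ≈id x≈gⁱ y≈gʲ _ _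
    with p-adic-decomposition p>1 i (s≤s z≤n) | p-adic-decomposition p>1 j (s≤s z≤n)
    where p>1 = nonTrivial⇒n>1 p {{prime⇒nonTrivial pp}}
  ... | a , u , i≡pᵃu , p∤u | b , v , j≡pᵇv , p∤v
    with subst (λ k → x ≈ g ^ₚ k) i≡pᵃu x≈gⁱ | subst (λ k → y ≈ g ^ₚ k) j≡pᵇv y≈gʲ | ≤-total a b
  ... | x≈ | y≈ | inj₁ a≤b = inj₂ (smaller-valuation⇒∈⟨⟩ {g} {x} {y} p c a b u v pp gᵖᶜ≈id x≈ y≈ p∤u a≤b)
  ... | x≈ | y≈ | inj₂ b≤a = inj₁ (smaller-valuation⇒∈⟨⟩ {g} {y} {x} p c b a v u pp gᵖᶜ≈id y≈ x≈ p∤v b≤a)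

  prime-order-power : ∀ {h : S n} m → 0 < m → h ^ₚ m ≈ id → ¬ h ≈ id →
                      ∃₂ λ q k → Prime q × q ∣ m × ¬ h ^ₚ k ≈ id × (h ^ₚ k) ^ₚ q ≈ id
  prime-order-power m m>0 = go m m>0 (<-wellFounded m)
    where
    go : ∀ {h : S n} m → 0 < m → Acc _<_ m → h ^ₚ m ≈ id → ¬ h ≈ id →
         ∃₂ λ q k → Prime q × q ∣ m × ¬ h ^ₚ k ≈ id × (h ^ₚ k) ^ₚ q ≈ id
    go 1 _ _ h¹≈id h≉id = contradiction h¹≈id h≉id
    go {h} m@(suc (suc _)) _ (acc rec) hᵐ≈id h≉id with prime? m
    ... | yes m-prime = m , 1 , m-prime , ∣-refl , h≉id , hᵐ≈id
    ... | no m-composite with ¬prime⇒composite m-composite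
    ... | hasNonTrivialDivisor {d} d<m (divides e@(suc _) m≡ed) with h ^ₚ d ≈? id
    ...   | yes hᵈ≈id with go d (<-trans (s≤s z≤n) (nonTrivial⇒n>1 d)) (rec d<m) hᵈ≈id h≉id
    ...     | q , k , q-prime , q∣d , hᵏ≉id , hᵏᑫ≈id =
      q , k , q-prime , ∣-trans q∣d (divides e m≡ed) , hᵏ≉id , hᵏᑫ≈id
    go {h} m _ (acc rec) hᵐ≈id h≉id | no _ | hasNonTrivialDivisor {d} d<m (divides e@(suc _) m≡ed)
      | no hᵈ≉id with go {h ^ₚ d} e (s≤s z≤n) (rec e<m) hᵈᵉ≈id hᵈ≉id
      where
      e<m : e < m
      e<m = subst (e <_) (sym m≡ed) (m<m*n e d (nonTrivial⇒n>1 d))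
      hᵈᵉ≈id : (h ^ₚ d) ^ₚ e ≈ id
      hᵈᵉ≈id z = begin
        ((h ^ₚ d) ^ₚ e) · z   ≡⟨ ^ₚ-* h d e z ⟨
        (h ^ₚ (d * e)) · z    ≡⟨ cong (λ k → (h ^ₚ k) · z) (trans (*-comm d e) (sym m≡ed)) ⟩
        (h ^ₚ m) · z          ≡⟨ hᵐ≈id z ⟩
        z                     ∎
    ...   | q , k , q-prime , q∣e , hᵈᵏ≉id , hᵈᵏᑫ≈id =
      q , d * k , q-prime , ∣-trans q∣e (divides d (trans m≡ed (*-comm e d))) ,
      (λ hᵈᵏ≈id → hᵈᵏ≉id λ z → trans (sym (^ₚ-* h d k z)) (hᵈᵏ≈id z)) ,
      (λ z → trans (^ₚ-cong q (^ₚ-* h d k) z) (hᵈᵏᑫ≈id z))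

  -- Transpositions, 3-cycles and disjoint supports

  private
    _∈?_ : (z : Fin n) (L : List (Fin n)) → Dec (z ∈ L)
    _∈?_ = ∈?-with _≟ᶠ_

  transpose-applyˡ : (i j : Fin n) → transpose i j · i ≡ j
  transpose-applyˡ i j with i ≟ᶠ i
  ... | yes _   = refl
  ... | no i≢i = contradiction refl i≢i

  transpose-applyʳ : (i j : Fin n) → transpose i j · j ≡ i
  transpose-applyʳ i j with j ≟ᶠ i
  ... | yes j≡i = j≡i
  ... | no _ with j ≟ᶠ j
  ...   | yes _   = refl
  ...   | no j≢j = contradiction refl j≢j

  transpose-fixes : ∀ (i j : Fin n) {z} → z ∉ i ∷ j ∷ [] → transpose i j · z ≡ z
  transpose-fixes i j {z} z∉ij with z ≟ᶠ i
  ... | yes z≡i = contradiction (here z≡i) z∉ij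
  ... | no _ with z ≟ᶠ j
  ...   | yes z≡j = contradiction (there (here z≡j)) z∉ij
  ...   | no _    = refl

  transpose-involutive : (i j : Fin n) → transpose i j ^ₚ 2 ≈ id
  transpose-involutive i j z = by-cases (z ≟ᶠ i) (z ≟ᶠ j)
    where
    t = transpose i j
    by-cases : Dec (z ≡ i) → Dec (z ≡ j) → t · t · z ≡ z
    by-cases (yes refl) _ = trans (cong (t ·_) (transpose-applyˡ i j)) (transpose-applyʳ i j)
    by-cases (no _) (yes refl) = trans (cong (t ·_) (transpose-applyʳ i j)) (transpose-applyˡ i j)
    by-cases (no z≢i) (no z≢j) = trans (cong (t ·_) tz≡z) tz≡z
      where
      tz≡z : t · z ≡ z
      tz≡z = transpose-fixes i j λ { (here z≡i) → z≢i z≡i ; (there (here z≡j)) → z≢j z≡j }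

  transpose-≉id : ∀ {i j : Fin n} → i ≢ j → ¬ transpose i j ≈ id
  transpose-≉id {i} {j} i≢j tᵢⱼ≈id = i≢j (sym (trans (sym (transpose-applyˡ i j)) (tᵢⱼ≈id i)))

  3-cycle : Fin n → Fin n → Fin n → S n
  3-cycle u v w = transpose u v ∘ₚ transpose u w

  module _ {u v w : Fin n} (u≢v : u ≢ v) (u≢w : u ≢ w) (v≢w : v ≢ w) where

    3-cycle-u : 3-cycle u v w · u ≡ v
    3-cycle-u = trans (cong (transpose u w ·_) (transpose-applyˡ u v))
                      (transpose-fixes u w λ { (here v≡u) → u≢v (sym v≡u) ; (there (here v≡w)) → v≢w v≡w })

    3-cycle-v : 3-cycle u v w · v ≡ w
    3-cycle-v = trans (cong (transpose u w ·_) (transpose-applyʳ u v)) (transpose-applyˡ u w)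

    3-cycle-w : 3-cycle u v w · w ≡ u
    3-cycle-w = trans (cong (transpose u w ·_)
                        (transpose-fixes u v λ { (here w≡u) → u≢w (sym w≡u) ; (there (here w≡v)) → v≢w (sym w≡v) }))
                      (transpose-applyʳ u w)

    3-cycle-fixes : ∀ {z} → z ∉ u ∷ v ∷ w ∷ [] → 3-cycle u v w · z ≡ z
    3-cycle-fixes z∉uvw =
      trans (cong (transpose u w ·_) (transpose-fixes u v λ { (here e) → z∉uvw (here e) ; (there (here e)) → z∉uvw (there (here e)) }))
            (transpose-fixes u w λ { (here e) → z∉uvw (here e) ; (there (here e)) → z∉uvw (there (there (here e))) })

    3-cycle-cube : 3-cycle u v w ^ₚ 3 ≈ id
    3-cycle-cube z = by-cases (z ≟ᶠ u) (z ≟ᶠ v) (z ≟ᶠ w)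
      where
      c = 3-cycle u v w
      by-cases : Dec (z ≡ u) → Dec (z ≡ v) → Dec (z ≡ w) → c · c · c · z ≡ z
      by-cases (yes refl) _ _ = trans (cong (λ t → c · c · t) 3-cycle-u) (trans (cong (c ·_) 3-cycle-v) 3-cycle-w)
      by-cases (no _) (yes refl) _ = trans (cong (λ t → c · c · t) 3-cycle-v) (trans (cong (c ·_) 3-cycle-w) 3-cycle-u)
      by-cases (no _) (no _) (yes refl) = trans (cong (λ t → c · c · t) 3-cycle-w) (trans (cong (c ·_) 3-cycle-u) 3-cycle-v)
      by-cases (no z≢u) (no z≢v) (no z≢w) = trans (cong (λ t → c · c · t) cz≡z) (trans (cong (c ·_) cz≡z) cz≡z)
        where
        cz≡z : c · z ≡ z
        cz≡z = 3-cycle-fixes λ { (here e) → z≢u e ; (there (here e)) → z≢v e ; (there (there (here e))) → z≢w e }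

    3-cycle-≉id : ¬ 3-cycle u v w ≈ id
    3-cycle-≉id c≈id = u≢v (sym (trans (sym 3-cycle-u) (c≈id u)))

  fixes-image-of-fixed : ∀ {x y : S n} → (∀ z → x · z ≡ z ⊎ y · z ≡ z) →
                         ∀ {z} → x · z ≡ z → x · y · z ≡ y · z
  fixes-image-of-fixed {x} {y} cover {z} xz≡z with cover (y · z)
  ... | inj₁ xyz≡yz = xyz≡yz
  ... | inj₂ yyz≡yz = trans (cong (x ·_) yz≡z) (trans xz≡z (sym yz≡z))
    where yz≡z = ·-injective y yyz≡yz

  disjoint⇒Commute : ∀ {x y : S n} → (∀ z → x · z ≡ z ⊎ y · z ≡ z) → Commute x y
  disjoint⇒Commute {x} {y} cover z with cover z
  ... | inj₁ xz≡z = trans (fixes-image-of-fixed {x} {y} cover xz≡z) (cong (y ·_) (sym xz≡z))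
  ... | inj₂ yz≡z = trans (cong (x ·_) yz≡z) (sym (fixes-image-of-fixed {y} {x} (⊎-swap ∘ cover) yz≡z))

  supported-in⇒Commute : ∀ {x y : S n} L → (∀ {z} → z ∉ L → x · z ≡ z) → All (λ z → y · z ≡ z) L → Commute x y
  supported-in⇒Commute {x} {y} L x-fixes y-fixes = disjoint⇒Commute {x} {y} cover
    where
    cover : ∀ z → x · z ≡ z ⊎ y · z ≡ z
    cover z with z ∈? L
    ... | yes z∈L = inj₂ (All-lookup y-fixes z∈L)
    ... | no z∉L  = inj₁ (x-fixes z∉L)

  fresh : (L : List (Fin n)) → length L < n → ∃ λ z → z ∉ L
  fresh L |L|<n with any? (λ z → ¬? (z ∈? L))
  ... | yes z∉L = z∉L
  ... | no ∄z∉L = contradiction (λ {z} {w} → index-injective {z} {w}) (<⇒notInjective |L|<n)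
    where
    covered : ∀ z → z ∈ L
    covered z = decidable-stable (z ∈? L) λ z∉L → ∄z∉L (z , z∉L)
    index-injective : ∀ {z w} → index (covered z) ≡ index (covered w) → z ≡ w
    index-injective {z} {w} eq =
      trans (lookup-index (covered z)) (trans (cong (lookup L) eq) (sym (lookup-index (covered w))))

  fresh-pair : (L : List (Fin n)) → 2 + length L ≤ n → ∃₂ λ s t → s ≢ t × s ∉ L × t ∉ L
  fresh-pair L 2+|L|≤n with fresh L (≤-trans (n≤1+n _) 2+|L|≤n)
  ... | s , s∉L with fresh (s ∷ L) 2+|L|≤n
  ... | t , t∉sL = s , t , (λ s≡t → t∉sL (here (sym s≡t))) , s∉L , t∉sL ∘ there

  moved-outside : ∀ (x : S n) L → (∃ λ z → x · z ≢ z × z ∉ L) ⊎ (∀ {z} → z ∉ L → x · z ≡ z)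
  moved-outside x L with any? (λ z → ¬? (x · z ≟ᶠ z) ×-dec ¬? (z ∈? L))
  ... | yes moved = inj₁ moved
  ... | no ∄moved = inj₂ λ {z} z∉L → decidable-stable (x · z ≟ᶠ z) λ xz≢z → ∄moved (z , xz≢z , z∉L)

  -- Paths from involutions to transpositions

  ReachesTransposition : S n → Set
  ReachesTransposition x = Σ (S n) λ τ → IsTransposition τ × DPath x τ

  fixed-pair⇒reaches-transposition : ∀ {y : S n} m {s t} → Coprime m 2 → y ^ₚ m ≈ id → ¬ y ≈ id →
                                     s ≢ t → y · s ≡ s → y · t ≡ t → ReachesTransposition y
  fixed-pair⇒reaches-transposition {y} m {s} {t} m⊥2 yᵐ≈id y≉id s≢t ys≡s yt≡t =
    transpose s t , (s , t , s≢t , λ _ → refl) ,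
    commuting-coprime⇒adjacent m 2 y⇄τ m⊥2 yᵐ≈id (transpose-involutive s t) y≉id (transpose-≉id s≢t) ◅ ε
    where
    y⇄τ : Commute y (transpose s t)
    y⇄τ = Commute-sym {transpose s t} {y}
            (supported-in⇒Commute {transpose s t} {y} (s ∷ t ∷ []) (transpose-fixes s t) (ys≡s ∷ yt≡t ∷ []))

  commuting-order-3⇒reaches-transposition : ∀ {x y : S n} {s t} → x ^ₚ 2 ≈ id → ¬ x ≈ id →
    Commute x y → y ^ₚ 3 ≈ id → ¬ y ≈ id → s ≢ t → y · s ≡ s → y · t ≡ t → ReachesTransposition x
  commuting-order-3⇒reaches-transposition {x} {y} x²≈id x≉id x⇄y y³≈id y≉id s≢t ys≡s yt≡t
    with fixed-pair⇒reaches-transposition {y} 3 (from-yes (coprime? 3 2)) y³≈id y≉id s≢t ys≡s yt≡t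
  ... | τ , τ-transposition , y⟶τ =
    τ , τ-transposition ,
    commuting-coprime⇒adjacent {x} {y} 2 3 x⇄y (from-yes (coprime? 2 3)) x²≈id y³≈id x≉id y≉id ◅ y⟶τ

  -- A 3-cycle on three fixed points of x.
  few-moved-points⇒reaches-transposition : ∀ {x : S n} L → 3 + length L ≤ n → 5 ≤ n →
    x ^ₚ 2 ≈ id → ¬ x ≈ id → (∀ {z} → z ∉ L → x · z ≡ z) → ReachesTransposition x
  few-moved-points⇒reaches-transposition {x} L 3+|L|≤n 5≤n x²≈id x≉id x-fixes
    with fresh L (≤-trans (m≤n+m _ 2) 3+|L|≤n)
  ... | u , u∉L with fresh-pair (u ∷ L) 3+|L|≤n
  ... | v , w , v≢w , v∉uL , w∉uL with fresh-pair (u ∷ v ∷ w ∷ []) 5≤n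
  ... | s , t , s≢t , s∉uvw , t∉uvw =
    commuting-order-3⇒reaches-transposition {x} {3-cycle u v w} x²≈id x≉id x⇄c
      (3-cycle-cube u≢v u≢w v≢w) (3-cycle-≉id u≢v u≢w v≢w) s≢t
      (3-cycle-fixes u≢v u≢w v≢w s∉uvw) (3-cycle-fixes u≢v u≢w v≢w t∉uvw)
    where
    u≢v : u ≢ v
    u≢v u≡v = v∉uL (here (sym u≡v))
    u≢w : u ≢ w
    u≢w u≡w = w∉uL (here (sym u≡w))
    x⇄c : Commute x (3-cycle u v w)
    x⇄c = Commute-sym {3-cycle u v w} {x}
            (supported-in⇒Commute {3-cycle u v w} {x} (u ∷ v ∷ w ∷ []) (3-cycle-fixes u≢v u≢w v≢w)
              (x-fixes u∉L ∷ x-fixes (v∉uL ∘ there) ∷ x-fixes (w∉uL ∘ there) ∷ []))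

  module _ {x f : S n} (x²≈id : x ^ₚ 2 ≈ id) where

    conjugate-^ₚ : ∀ k → (x ∘ₚ f ∘ₚ x) ^ₚ k ≈ x ∘ₚ (f ^ₚ k) ∘ₚ x
    conjugate-^ₚ zero z = sym (x²≈id z)
    conjugate-^ₚ (suc k) z =
      trans (conjugate-^ₚ k (x · f · x · z)) (cong (λ w → x · (f ^ₚ k) · w) (x²≈id (f · x · z)))

    module _ (f⇄fˣ : Commute f (x ∘ₚ f ∘ₚ x)) where

      Commute-conjugate-product : Commute x ((x ∘ₚ f ∘ₚ x) ∘ₚ f)
      Commute-conjugate-product z = begin
        x · f · x · f · x · z      ≡⟨ cong (x ·_) (f⇄fˣ z) ⟩
        x · x · f · x · f · z      ≡⟨ x²≈id (f · x · f · z) ⟩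
        f · x · f · z              ≡⟨ cong (λ w → f · x · f · w) (x²≈id z) ⟨
        f · x · f · x · x · z      ∎

      conjugate-product-cube : f ^ₚ 3 ≈ id → ((x ∘ₚ f ∘ₚ x) ∘ₚ f) ^ₚ 3 ≈ id
      conjugate-product-cube f³≈id z = begin
        (((x ∘ₚ f ∘ₚ x) ∘ₚ f) ^ₚ 3) · z          ≡⟨ Commute⇒∘ₚ-^ₚ {x ∘ₚ f ∘ₚ x} {f}
                                                      (Commute-sym {f} {x ∘ₚ f ∘ₚ x} f⇄fˣ) 3 z ⟩
        ((x ∘ₚ f ∘ₚ x) ^ₚ 3) · (f ^ₚ 3) · z      ≡⟨ cong ((x ∘ₚ f ∘ₚ x) ^ₚ 3 ·_) (f³≈id z) ⟩
        ((x ∘ₚ f ∘ₚ x) ^ₚ 3) · z                 ≡⟨ conjugate-^ₚ 3 z ⟩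
        x · (f ^ₚ 3) · x · z                     ≡⟨ cong (x ·_) (f³≈id (x · z)) ⟩
        x · x · z                                ≡⟨ x²≈id z ⟩
        z                                        ∎

  -- The involution x centralises y = (x f x) f for the 3-cycle f = (a b c), which moves only a, b, c
  -- and their images under x.
  conjugate-3-cycle⇒reaches-transposition : ∀ {x : S n} {a b c} → 8 ≤ n → x ^ₚ 2 ≈ id → ¬ x ≈ id →
    a ≢ b → a ≢ c → b ≢ c → All (λ w → x · w ∉ a ∷ b ∷ c ∷ []) (a ∷ b ∷ c ∷ []) → ReachesTransposition x
  conjugate-3-cycle⇒reaches-transposition {x} {a} {b} {c} 8≤n x²≈id x≉id a≢b a≢c b≢c (xa∉ ∷ xb∉ ∷ xc∉ ∷ [])
    with fresh-pair (abc ++ map (x ·_) abc) 8≤n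
    where abc = a ∷ b ∷ c ∷ []
  ... | s , t , s≢t , s∉ , t∉ =
    commuting-order-3⇒reaches-transposition {x} {y} x²≈id x≉id
      (Commute-conjugate-product {x} {f} x²≈id f⇄fˣ) (conjugate-product-cube {x} {f} x²≈id f⇄fˣ f³≈id)
      y≉id s≢t (y-fixes s∉) (y-fixes t∉)
    where
    abc = a ∷ b ∷ c ∷ []
    f = 3-cycle a b c
    fˣ = x ∘ₚ f ∘ₚ x
    y = fˣ ∘ₚ f
    f-fixes : ∀ {z} → z ∉ abc → f · z ≡ z
    f-fixes = 3-cycle-fixes a≢b a≢c b≢c
    f³≈id : f ^ₚ 3 ≈ id
    f³≈id = 3-cycle-cube a≢b a≢c b≢c
    fˣ-fixes : ∀ {z} → x · z ∉ abc → fˣ · z ≡ z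
    fˣ-fixes {z} xz∉ = trans (cong (x ·_) (f-fixes xz∉)) (x²≈id z)
    f⇄fˣ : Commute f fˣ
    f⇄fˣ = supported-in⇒Commute {f} {fˣ} abc f-fixes (fˣ-fixes xa∉ ∷ fˣ-fixes xb∉ ∷ fˣ-fixes xc∉ ∷ [])
    y≉id : ¬ y ≈ id
    y≉id y≈id = a≢b (trans (sym (y≈id a)) (trans (cong (f ·_) (fˣ-fixes xa∉)) (3-cycle-u a≢b a≢c b≢c)))
    x-image-∉ : ∀ {z} → z ∉ map (x ·_) abc → x · z ∉ abc
    x-image-∉ {z} z∉ xz∈ = z∉ (subst (_∈ map (x ·_) abc) (x²≈id z) (∈-map⁺ (x ·_) xz∈))
    y-fixes : ∀ {z} → z ∉ abc ++ map (x ·_) abc → y · z ≡ z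
    y-fixes {z} z∉ = trans (cong (f ·_) (fˣ-fixes (x-image-∉ (z∉ ∘ ∈-++⁺ʳ abc)))) (f-fixes (z∉ ∘ ∈-++⁺ˡ))

  three-2-cycles : ∀ {x : S n} {a b c} → x ^ₚ 2 ≈ id → x · a ≢ a → x · b ≢ b → x · c ≢ c →
    b ∉ a ∷ x · a ∷ [] → c ∉ a ∷ x · a ∷ b ∷ x · b ∷ [] →
    a ≢ b × a ≢ c × b ≢ c × All (λ w → x · w ∉ a ∷ b ∷ c ∷ []) (a ∷ b ∷ c ∷ [])
  three-2-cycles {x} {a} {b} {c} x²≈id xa≢a xb≢b xc≢c b∉ c∉ =
    b∉ ∘ here ∘ sym , c∉ ∘ here ∘ sym , c∉ ∘ there ∘ there ∘ here ∘ sym , xa∉ ∷ xb∉ ∷ xc∉ ∷ []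
    where
    x-swap : ∀ {z w} → x · z ≡ w → z ≡ x · w
    x-swap {z} xz≡w = trans (sym (x²≈id z)) (cong (x ·_) xz≡w)
    xa∉ : x · a ∉ a ∷ b ∷ c ∷ []
    xa∉ (here xa≡a) = xa≢a xa≡a
    xa∉ (there (here xa≡b)) = b∉ (there (here (sym xa≡b)))
    xa∉ (there (there (here xa≡c))) = c∉ (there (here (sym xa≡c)))
    xb∉ : x · b ∉ a ∷ b ∷ c ∷ []
    xb∉ (here xb≡a) = b∉ (there (here (x-swap xb≡a)))
    xb∉ (there (here xb≡b)) = xb≢b xb≡b
    xb∉ (there (there (here xb≡c))) = c∉ (there (there (there (here (sym xb≡c)))))
    xc∉ : x · c ∉ a ∷ b ∷ c ∷ []
    xc∉ (here xc≡a) = c∉ (there (here (x-swap xc≡a)))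
    xc∉ (there (here xc≡b)) = c∉ (there (there (there (here (x-swap xc≡b)))))
    xc∉ (there (there (here xc≡c))) = xc≢c xc≡c

  involution⇒reaches-transposition : ∀ {x : S n} → 8 ≤ n → x ^ₚ 2 ≈ id → ¬ x ≈ id → ReachesTransposition x
  involution⇒reaches-transposition {x} 8≤n x²≈id x≉id with moved-outside x []
  ... | inj₂ fixes-all = contradiction (λ z → fixes-all λ ()) x≉id
  ... | inj₁ (a , xa≢a , _) with moved-outside x (a ∷ x · a ∷ [])
  ... | inj₂ fixes-rest =
    few-moved-points⇒reaches-transposition _ (≤-trans (m≤m+n 5 3) 8≤n) (≤-trans (m≤m+n 5 3) 8≤n) x²≈id x≉id fixes-rest
  ... | inj₁ (b , xb≢b , b∉) with moved-outside x (a ∷ x · a ∷ b ∷ x · b ∷ [])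
  ... | inj₂ fixes-rest =
    few-moved-points⇒reaches-transposition _ (≤-trans (m≤m+n 7 1) 8≤n) (≤-trans (m≤m+n 5 3) 8≤n) x²≈id x≉id fixes-rest
  ... | inj₁ (c , xc≢c , c∉) =
    let a≢b , a≢c , b≢c , images∉ = three-2-cycles {x} x²≈id xa≢a xb≢b xc≢c b∉ c∉
    in conjugate-3-cycle⇒reaches-transposition 8≤n x²≈id x≉id a≢b a≢c b≢c images∉

  -- Elements of odd prime order

  module Orbits {h : S n} {q : ℕ} (q-prime : Prime q) (hᑫ≈id : h ^ₚ q ≈ id) where

    instance
      q≢0 : NonZero q
      q≢0 = prime⇒nonZero q-prime

    moved⇒q∣period : ∀ {u} d → h · u ≢ u → (h ^ₚ d) · u ≡ u → q ∣ d
    moved⇒q∣period {u} d hu≢u hᵈu≡u with q ∣? d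
    ... | yes q∣d = q∣d
    ... | no q∤d = contradiction (fixed-by-coprime-powers h d q (prime∤⇒coprime q-prime q∤d) hᵈu≡u (hᑫ≈id u)) hu≢u

    q∣⇒^ₚ≈id : ∀ d → q ∣ d → h ^ₚ d ≈ id
    q∣⇒^ₚ≈id d (divides k d≡kq) z = subst (λ e → (h ^ₚ e) · z ≡ z) (sym d≡kq) (^ₚ-*-≈id h {q} k hᑫ≈id z)

    moved-point-separates-powers-≤ : ∀ {u} → h · u ≢ u → ∀ {i j} → i ≤ j →
                                     (h ^ₚ i) · u ≡ (h ^ₚ j) · u → h ^ₚ i ≈ h ^ₚ j
    moved-point-separates-powers-≤ {u} hu≢u {i} {j} i≤j hⁱu≡hʲu z = begin
      (h ^ₚ i) · z                 ≡⟨ cong ((h ^ₚ i) ·_) (hᵈ≈id z) ⟨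
      (h ^ₚ i) · (h ^ₚ d) · z      ≡⟨ ^ₚ-+ h i d z ⟨
      (h ^ₚ (i + d)) · z           ≡⟨ cong (λ k → (h ^ₚ k) · z) (m+[n∸m]≡n i≤j) ⟩
      (h ^ₚ j) · z                 ∎
      where
      d = j ∸ i
      hᵈu≡u : (h ^ₚ d) · u ≡ u
      hᵈu≡u = ·-injective (h ^ₚ i) (begin
        (h ^ₚ i) · (h ^ₚ d) · u    ≡⟨ ^ₚ-+ h i d u ⟨
        (h ^ₚ (i + d)) · u         ≡⟨ cong (λ k → (h ^ₚ k) · u) (m+[n∸m]≡n i≤j) ⟩
        (h ^ₚ j) · u               ≡⟨ hⁱu≡hʲu ⟨
        (h ^ₚ i) · u               ∎)
      hᵈ≈id : h ^ₚ d ≈ id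
      hᵈ≈id = q∣⇒^ₚ≈id d (moved⇒q∣period d hu≢u hᵈu≡u)

    moved-point-separates-powers : ∀ {u} → h · u ≢ u → ∀ i j → (h ^ₚ i) · u ≡ (h ^ₚ j) · u → h ^ₚ i ≈ h ^ₚ j
    moved-point-separates-powers hu≢u i j hⁱu≡hʲu with ≤-total i j
    ... | inj₁ i≤j = moved-point-separates-powers-≤ hu≢u i≤j hⁱu≡hʲu
    ... | inj₂ j≤i = λ z → sym (moved-point-separates-powers-≤ hu≢u j≤i (sym hⁱu≡hʲu) z)

    InOrbit : Fin n → Fin n → Set
    InOrbit u z = ∃ λ (k : Fin q) → z ≡ (h ^ₚ toℕ k) · u

    inOrbit? : ∀ u z → Dec (InOrbit u z)
    inOrbit? u z = any? λ k → z ≟ᶠ (h ^ₚ toℕ k) · u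

    power-∈orbit : ∀ u m → InOrbit u ((h ^ₚ m) · u)
    power-∈orbit u m = fromℕ< (m%n<n m q) , (begin
      (h ^ₚ m) · u                                   ≡⟨ cong (λ k → (h ^ₚ k) · u) (m≡m%n+[m/n]*n m q) ⟩
      (h ^ₚ (m % q + m / q * q)) · u                 ≡⟨ ^ₚ-+ h (m % q) (m / q * q) u ⟩
      (h ^ₚ (m % q)) · (h ^ₚ (m / q * q)) · u        ≡⟨ cong ((h ^ₚ (m % q)) ·_) (^ₚ-*-≈id h {q} (m / q) hᑫ≈id u) ⟩
      (h ^ₚ (m % q)) · u                             ≡⟨ cong (λ k → (h ^ₚ k) · u) (toℕ-fromℕ< (m%n<n m q)) ⟨
      (h ^ₚ toℕ (fromℕ< (m%n<n m q))) · u            ∎)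

    InOrbit-^ₚ : ∀ {u z} → InOrbit u z → ∀ m → InOrbit u ((h ^ₚ m) · z)
    InOrbit-^ₚ {u} (k , refl) m = subst (InOrbit u) (^ₚ-+ h m (toℕ k) u) (power-∈orbit u (m + toℕ k))

    InOrbit-unstep : ∀ {u z} → InOrbit u (h · z) → InOrbit u z
    InOrbit-unstep {u} {z} hz∈ = subst (InOrbit u) hᑫz≡z (InOrbit-^ₚ hz∈ (q ∸ 1))
      where
      hᑫz≡z : (h ^ₚ (q ∸ 1)) · h · z ≡ z
      hᑫz≡z = trans (sym (^ₚ-+ h (q ∸ 1) 1 z))
                    (trans (cong (λ k → (h ^ₚ k) · z) (m∸n+n≡m (<⇒≤ (nonTrivial⇒n>1 q {{prime⇒nonTrivial q-prime}}))))
                           (hᑫ≈id z))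

    InOrbit-un^ₚ : ∀ {u z} m → InOrbit u ((h ^ₚ m) · z) → InOrbit u z
    InOrbit-un^ₚ zero z∈ = z∈
    InOrbit-un^ₚ (suc m) hᵐ⁺¹z∈ = InOrbit-unstep (InOrbit-un^ₚ m hᵐ⁺¹z∈)

    single-orbit⇒centraliser-cyclic : ∀ {σ : S n} {a} → h · a ≢ a →
      (∀ {u v} → h · u ≡ u → h · v ≡ v → u ≡ v) → (∀ {z} → h · z ≢ z → InOrbit a z) →
      Commute σ h → ∃ λ j → σ ≈ h ^ₚ j
    single-orbit⇒centraliser-cyclic {σ} {a} ha≢a fixed-unique moved-in-orbit σ⇄h
      with moved-in-orbit {σ · a} (λ hσa≡σa → ha≢a (·-injective σ (trans (σ⇄h a) hσa≡σa)))
    ... | k , σa≡hʲa = j , σ≈hʲ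
      where
      j = toℕ k
      σ≈hʲ : σ ≈ h ^ₚ j
      σ≈hʲ z with h · z ≟ᶠ z
      ... | yes hz≡z = trans (fixed-unique (trans (sym (σ⇄h z)) (cong (σ ·_) hz≡z)) hz≡z) (sym (^ₚ-fixes h j hz≡z))
      ... | no hz≢z with moved-in-orbit hz≢z
      ...   | m , refl = begin
        σ · (h ^ₚ toℕ m) · a          ≡⟨ Commute-^ₚʳ {σ} {h} σ⇄h (toℕ m) a ⟩
        (h ^ₚ toℕ m) · σ · a          ≡⟨ cong ((h ^ₚ toℕ m) ·_) σa≡hʲa ⟩
        (h ^ₚ toℕ m) · (h ^ₚ j) · a   ≡⟨ ^ₚ-commute h (toℕ m) j a ⟩
        (h ^ₚ j) · (h ^ₚ toℕ m) · a   ∎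

    -- The involution exchanging hᵐ a and hᵐ b, well defined because hᵐ u determines hᵐ for a moved point u.
    module SwapOrbits {a b : Fin n} (ha≢a : h · a ≢ a) (hb≢b : h · b ≢ b) (b∉⟨a⟩ : ¬ InOrbit a b) where

      swap-fun : Fin n → Fin n
      swap-fun z with inOrbit? a z
      ... | yes (k , _) = (h ^ₚ toℕ k) · b
      ... | no _ with inOrbit? b z
      ...   | yes (k , _) = (h ^ₚ toℕ k) · a
      ...   | no _ = z

      swap-a : ∀ m → swap-fun ((h ^ₚ m) · a) ≡ (h ^ₚ m) · b
      swap-a m with inOrbit? a ((h ^ₚ m) · a)
      ... | yes (k , hᵐa≡hᵏa) = moved-point-separates-powers ha≢a (toℕ k) m (sym hᵐa≡hᵏa) b
      ... | no hᵐa∉⟨a⟩ = contradiction (power-∈orbit a m) hᵐa∉⟨a⟩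

      swap-b : ∀ m → swap-fun ((h ^ₚ m) · b) ≡ (h ^ₚ m) · a
      swap-b m with inOrbit? a ((h ^ₚ m) · b)
      ... | yes hᵐb∈⟨a⟩ = contradiction (InOrbit-un^ₚ m hᵐb∈⟨a⟩) b∉⟨a⟩
      ... | no _ with inOrbit? b ((h ^ₚ m) · b)
      ...   | yes (k , hᵐb≡hᵏb) = moved-point-separates-powers hb≢b (toℕ k) m (sym hᵐb≡hᵏb) a
      ...   | no hᵐb∉⟨b⟩ = contradiction (power-∈orbit b m) hᵐb∉⟨b⟩

      swap-elsewhere : ∀ {z} → ¬ InOrbit a z → ¬ InOrbit b z → swap-fun z ≡ z
      swap-elsewhere {z} z∉⟨a⟩ z∉⟨b⟩ with inOrbit? a z
      ... | yes z∈⟨a⟩ = contradiction z∈⟨a⟩ z∉⟨a⟩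
      ... | no _ with inOrbit? b z
      ...   | yes z∈⟨b⟩ = contradiction z∈⟨b⟩ z∉⟨b⟩
      ...   | no _ = refl

      data Position (z : Fin n) : Set where
        in-orbit-a : ∀ m → z ≡ (h ^ₚ m) · a → Position z
        in-orbit-b : ∀ m → z ≡ (h ^ₚ m) · b → Position z
        elsewhere  : ¬ InOrbit a z → ¬ InOrbit b z → Position z

      position : ∀ z → Position z
      position z with inOrbit? a z | inOrbit? b z
      ... | yes (k , z≡hᵏa) | _ = in-orbit-a (toℕ k) z≡hᵏa
      ... | no _ | yes (k , z≡hᵏb) = in-orbit-b (toℕ k) z≡hᵏb
      ... | no z∉⟨a⟩ | no z∉⟨b⟩ = elsewhere z∉⟨a⟩ z∉⟨b⟩

      swap-involutive : ∀ z → swap-fun (swap-fun z) ≡ z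
      swap-involutive z with position z
      ... | in-orbit-a m refl = trans (cong swap-fun (swap-a m)) (swap-b m)
      ... | in-orbit-b m refl = trans (cong swap-fun (swap-b m)) (swap-a m)
      ... | elsewhere z∉⟨a⟩ z∉⟨b⟩ = trans (cong swap-fun (swap-elsewhere z∉⟨a⟩ z∉⟨b⟩)) (swap-elsewhere z∉⟨a⟩ z∉⟨b⟩)

      swap : S n
      swap = permutation swap-fun swap-fun swap-involutive swap-involutive

      swap²≈id : swap ^ₚ 2 ≈ id
      swap²≈id = swap-involutive

      swap-≉id : ¬ swap ≈ id
      swap-≉id swap≈id = b∉⟨a⟩ (subst (InOrbit a) (trans (sym (swap≈id a)) (swap-a 0)) (power-∈orbit a 0))

      Commute-h-swap : Commute h swap
      Commute-h-swap z with position z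
      ... | in-orbit-a m refl = begin
        h · swap-fun ((h ^ₚ m) · a)       ≡⟨ cong (h ·_) (swap-a m) ⟩
        h · (h ^ₚ m) · b                  ≡⟨ ^ₚ-self-commute h m b ⟨
        (h ^ₚ suc m) · b                  ≡⟨ swap-a (suc m) ⟨
        swap-fun ((h ^ₚ suc m) · a)       ≡⟨ cong swap-fun (^ₚ-self-commute h m a) ⟩
        swap-fun (h · (h ^ₚ m) · a)       ∎
      ... | in-orbit-b m refl = begin
        h · swap-fun ((h ^ₚ m) · b)       ≡⟨ cong (h ·_) (swap-b m) ⟩
        h · (h ^ₚ m) · a                  ≡⟨ ^ₚ-self-commute h m a ⟨
        (h ^ₚ suc m) · a                  ≡⟨ swap-b (suc m) ⟨
        swap-fun ((h ^ₚ suc m) · b)       ≡⟨ cong swap-fun (^ₚ-self-commute h m b) ⟩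
        swap-fun (h · (h ^ₚ m) · b)       ∎
      ... | elsewhere z∉⟨a⟩ z∉⟨b⟩ =
        trans (cong (h ·_) (swap-elsewhere z∉⟨a⟩ z∉⟨b⟩))
              (sym (swap-elsewhere (z∉⟨a⟩ ∘ InOrbit-unstep) (z∉⟨b⟩ ∘ InOrbit-unstep)))

      reaches-transposition : 8 ≤ n → Coprime q 2 → ReachesTransposition h
      reaches-transposition 8≤n q⊥2 with involution⇒reaches-transposition 8≤n swap²≈id swap-≉id
      ... | τ , τ-transposition , swap⟶τ =
        τ , τ-transposition ,
        commuting-coprime⇒adjacent {h} {swap} q 2 Commute-h-swap q⊥2 hᑫ≈id swap²≈id h≉id swap-≉id ◅ swap⟶τ
        where
        h≉id : ¬ h ≈ id
        h≉id h≈id = ha≢a (h≈id a)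

    odd-prime-order⇒reaches-transposition : ∀ {σ : S n} N → 8 ≤ n → Coprime q 2 → ¬ h ≈ id →
      Commute σ h → σ ^ₚ N ≈ id → Coprime N q → ¬ σ ≈ id → ReachesTransposition h
    odd-prime-order⇒reaches-transposition {σ} N 8≤n q⊥2 h≉id σ⇄h σᴺ≈id N⊥q σ≉id
      with any? (λ u → any? (λ v → ¬? (u ≟ᶠ v) ×-dec (h · u ≟ᶠ u) ×-dec (h · v ≟ᶠ v)))
         | ¬∀⟶∃¬ n (λ z → h · z ≡ z) (λ z → h · z ≟ᶠ z) h≉id
    ... | yes (u , v , u≢v , hu≡u , hv≡v) | _ =
      fixed-pair⇒reaches-transposition {h} q q⊥2 hᑫ≈id h≉id u≢v hu≡u hv≡v
    ... | no ∄fixed-pair | a , ha≢a with any? (λ b → ¬? (h · b ≟ᶠ b) ×-dec ¬? (inOrbit? a b))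
    ... | yes (b , hb≢b , b∉⟨a⟩) = SwapOrbits.reaches-transposition ha≢a hb≢b b∉⟨a⟩ 8≤n q⊥2
    ... | no ∄moved-outside-⟨a⟩ = contradiction (coprime-powers⇒≈id N q N⊥q σᴺ≈id σᑫ≈id) σ≉id
      where
      fixed-unique : ∀ {u v} → h · u ≡ u → h · v ≡ v → u ≡ v
      fixed-unique {u} {v} hu≡u hv≡v with u ≟ᶠ v
      ... | yes u≡v = u≡v
      ... | no u≢v = contradiction (u , v , u≢v , hu≡u , hv≡v) ∄fixed-pair
      moved-in-orbit : ∀ {z} → h · z ≢ z → InOrbit a z
      moved-in-orbit {z} hz≢z with inOrbit? a z
      ... | yes z∈⟨a⟩ = z∈⟨a⟩
      ... | no z∉⟨a⟩ = contradiction (z , hz≢z , z∉⟨a⟩) ∄moved-outside-⟨a⟩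
      σᑫ≈id : σ ^ₚ q ≈ id
      σᑫ≈id with single-orbit⇒centraliser-cyclic {σ} ha≢a fixed-unique moved-in-orbit σ⇄h
      ... | j , σ≈hʲ = ≈^ₚ⇒^ₚ≈id j q σ≈hʲ hᑫ≈id

  -- If g ^ (p ^ c) = id, then ⟨g⟩ is a p-group and x, y would be comparable; so g ^ (p ^ c) ≠ id
  -- has a power of prime order q dividing m.
  incomparable⇒commuting-prime-order : ∀ {g x y : S n} p c m i j → Prime p → ¬ p ∣ m →
    g ^ₚ (p ^ c * m) ≈ id → x ≈ g ^ₚ i → y ≈ g ^ₚ j → ¬ x ∈⟨ y ⟩ → ¬ y ∈⟨ x ⟩ →
    ∃₂ λ h q → Prime q × ¬ p ∣ q × ¬ h ≈ id × h ^ₚ q ≈ id × Commute x h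
  incomparable⇒commuting-prime-order {g} {x} {y} p c m i j p-prime p∤m gᵖᶜᵐ≈id x≈gⁱ y≈gʲ x∉⟨y⟩ y∉⟨x⟩
    with prime-order-power {g ^ₚ (p ^ c)} m m>0 gᵖᶜ^m≈id gᵖᶜ≉id
    where
    m>0 : 0 < m
    m>0 = n≢0⇒n>0 λ { refl → p∤m (p ∣0) }
    gᵖᶜ^m≈id : (g ^ₚ (p ^ c)) ^ₚ m ≈ id
    gᵖᶜ^m≈id z = trans (sym (^ₚ-* g (p ^ c) m z)) (gᵖᶜᵐ≈id z)
    gᵖᶜ≉id : ¬ g ^ₚ (p ^ c) ≈ id
    gᵖᶜ≉id gᵖᶜ≈id = [ x∉⟨y⟩ , y∉⟨x⟩ ]
      (prime-power-cyclic⇒comparable {g} {x} {y} p c i j p-prime gᵖᶜ≈id x≈gⁱ y≈gʲ (∉⟨⟩⇒≉id {x} {y} x∉⟨y⟩) (∉⟨⟩⇒≉id {y} {x} y∉⟨x⟩))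
  ... | q , k , q-prime , q∣m , h≉id , hᑫ≈id =
    (g ^ₚ (p ^ c)) ^ₚ k , q , q-prime , (λ p∣q → p∤m (∣-trans p∣q q∣m)) , h≉id , hᑫ≈id ,
    powers-commute {g} {x} {(g ^ₚ (p ^ c)) ^ₚ k} i (p ^ c * k) x≈gⁱ (λ z → sym (^ₚ-* g (p ^ c) k z))

  adjacent⇒commuting-prime-order : ∀ {x y : S n} p → Prime p → DAdj x y →
    ∃₂ λ h q → Prime q × ¬ p ∣ q × ¬ h ≈ id × h ^ₚ q ≈ id × Commute x h
  adjacent⇒commuting-prime-order {x} {y} p p-prime ((g , _ , x∈⟨g⟩ , y∈⟨g⟩) , x∉⟨y⟩ , y∉⟨x⟩)
    with finite-order g
  ... | M , M>0 , gᴹ≈id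
    with ∈⟨⟩⇒≈^ₚ {x} {g} M M>0 gᴹ≈id x∈⟨g⟩ | ∈⟨⟩⇒≈^ₚ {y} {g} M M>0 gᴹ≈id y∈⟨g⟩
       | p-adic-decomposition (nonTrivial⇒n>1 p {{prime⇒nonTrivial p-prime}}) M M>0
  ... | i , x≈gⁱ | j , y≈gʲ | c , m , M≡pᶜm , p∤m =
    incomparable⇒commuting-prime-order {g} {x} {y} p c m i j p-prime p∤m
      (subst (λ e → g ^ₚ e ≈ id) M≡pᶜm gᴹ≈id) x≈gⁱ y≈gʲ x∉⟨y⟩ y∉⟨x⟩

  commuting-prime-order⇒reaches-transposition : ∀ {σ h : S n} N q → 8 ≤ n → Prime q → Coprime N q →
    σ ^ₚ N ≈ id → ¬ σ ≈ id → h ^ₚ q ≈ id → ¬ h ≈ id → Commute σ h → ReachesTransposition σ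
  commuting-prime-order⇒reaches-transposition {σ} {h} N q 8≤n q-prime N⊥q σᴺ≈id σ≉id hᑫ≈id h≉id σ⇄h
    with h-reaches-transposition
    where
    h-reaches-transposition : ReachesTransposition h
    h-reaches-transposition with q ≟ 2
    ... | yes refl = involution⇒reaches-transposition 8≤n hᑫ≈id h≉id
    ... | no q≢2 =
      Orbits.odd-prime-order⇒reaches-transposition q-prime hᑫ≈id {σ = σ} N 8≤n q⊥2 h≉id σ⇄h σᴺ≈id N⊥q σ≉id
      where q⊥2 = prime⇒coprime q-prime (≤∧≢⇒< (nonTrivial⇒n>1 q {{prime⇒nonTrivial q-prime}}) (≢-sym q≢2))
  ... | τ , τ-transposition , h⟶τ =
    τ , τ-transposition , commuting-coprime⇒adjacent N q σ⇄h N⊥q σᴺ≈id hᑫ≈id σ≉id h≉id ◅ h⟶τ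

lemma4p3 : (n : ℕ) → 8 ≤ n → (σ : S n) → DVertex σ →
    (p α : ℕ) → Prime p → ¬ (2 ∣ p) → HasOrder σ (p ^ α) →
    Σ (S n) λ τ → IsTransposition τ × DPath σ τ
lemma4p3 n 8≤n σ (y , σ~y@(_ , σ∉⟨y⟩ , _)) p α p-prime _ (_ , σᵖᵅ≈id , _) =
  let h , q , q-prime , p∤q , h≉id , hᑫ≈id , σ⇄h = adjacent⇒commuting-prime-order p p-prime σ~y in
  commuting-prime-order⇒reaches-transposition (p ^ α) q 8≤n q-prime
    (coprime-sym (coprime-^ʳ (prime∤⇒coprime p-prime p∤q) α))
    σᵖᵅ≈id (∉⟨⟩⇒≉id {x = σ} {y = y} σ∉⟨y⟩) hᑫ≈id h≉id σ⇄h
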